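{- Let $\varphi$ be a prime, $x>1$ an integer, and $\omega_\varphi$ the number of distinct prime factors of $x^\varphi-1$. Let $k'$ be the index with $\varphi=r_{k',0}$, and put $I^-=\{k\in\mathbb{Z}:0\le k<k'\}$, $I^+=\{k\in\mathbb{Z}:k'\le k<\omega_\varphi\}$. If $\varphi\nmid x^\varphi-1$, then $$x\ge\min\Big[\big\{\max\{1+R_k^0,(1+R_k^0R_k^1)^{1/\varphi}\}: k\in I^-\big\}\cup\big\{\max\{1+\varphi^{ -1}R_{k+1}^0,(1+\varphi^{ -1}R_{k+1}^0R_k^1)^{1/\varphi}\}: k\in I^+\big\}\Big].$$ If $\varphi\mid x^\varphi-1$, then $$x\ge\min\Big[\big\{\max\{1+\varphi R_{k-1}^0,(1+\varphi^2R_{k-1}^0R_k^1)^{1/\varphi}\}: k\in I^-\big\}\cup\big\{\max\{1+R_k^0,(1+\varphi R_k^0R_k^1)^{1/\varphi}\}: k\in I^+\big\}\Big].$$ In each minimum, only those $k$ are admitted for which all quantities occurring are defined (i.e. the relevant index of $R^0$ lies between $0$ and $|\Pi_\varphi^0|$).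
   Context: $\Pi_\varphi^0$ is the set of primes $\rho$ with $\rho\not\equiv1\pmod\varphi$ (it contains $\varphi$) and $\Pi_\varphi^1$ the set of primes with $\rho\equiv1\pmod\varphi$; $r_{i,0},r_{i,1}$ are their $i$-th smallest elements. $R_k^0=\prod_{i=1}^k r_{i,0}$ and $R_k^1=\prod_{j=1}^{\omega_\varphi-k}r_{j,1}$, empty products being $1$. -}

module Defs where

open import Data.Nat using (ℕ; zero; suc; _+_; _*_; _∸_; _^_; _≤_; _<_)
open import Data.Nat.Divisibility using (_∣_; _∣?_)
open import Data.Nat.Primality using (Prime; prime?)
open import Data.List using (List; filter; upTo; length)
open import Data.Nat.ListAction using (product)
open import Data.Product using (Σ; ∃; _×_)
open import Data.Sum using (_⊎_)
open import Relation.Nullary using (¬_)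
open import Relation.Nullary.Decidable using (_×-dec_; ¬?)
open import Relation.Unary using (Pred; Decidable)
open import Relation.Binary.PropositionalEquality using (_≡_)
open import Level using (0ℓ)

Π⁰ : ℕ → Pred ℕ 0ℓ
Π⁰ φ ρ = Prime ρ × ¬ (φ ∣ ρ ∸ 1)

Π⁰? : (φ : ℕ) → Decidable (Π⁰ φ)
Π⁰? φ ρ = prime? ρ ×-dec ¬? (φ ∣? (ρ ∸ 1))

Π¹ : ℕ → Pred ℕ 0ℓ
Π¹ φ ρ = Prime ρ × (φ ∣ ρ ∸ 1)

Π¹? : (φ : ℕ) → Decidable (Π¹ φ)
Π¹? φ ρ = prime? ρ ×-dec (φ ∣? (ρ ∸ 1))

below : {P : Pred ℕ 0ℓ} → Decidable P → ℕ → List ℕ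
below P? n = filter P? (upTo n)

-- "R is the product of the k smallest elements of the set P" (this product
-- exists iff P has at least k elements; the empty product is 1).
-- The k smallest elements are exactly the elements below some bound n,
-- when exactly k of them lie below n.
IsPrefixProd : {P : Pred ℕ 0ℓ} → Decidable P → ℕ → ℕ → Set
IsPrefixProd P? k R = Σ ℕ λ n → length (below P? n) ≡ k × product (below P? n) ≡ R

IsR⁰ : ℕ → ℕ → ℕ → Set
IsR⁰ φ k R = IsPrefixProd (Π⁰? φ) k R

-- product of the j smallest elements of Π¹_φ (R¹_k is this with j = ω_φ - k)
IsR¹ : ℕ → ℕ → ℕ → Set
IsR¹ φ j R = IsPrefixProd (Π¹? φ) j R

-- ω_φ : number of distinct prime factors of x^φ - 1 (all are ≤ x^φ - 1)
ω : ℕ → ℕ → ℕ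
ω φ x = length (filter (λ p → prime? p ×-dec (p ∣? (x ^ φ ∸ 1))) (upTo (suc (x ^ φ ∸ 1))))

-- k' : the index with φ = r_{k',0}  (1 + number of elements of Π⁰ below φ)
k′ : ℕ → ℕ
k′ φ = suc (length (below (Π⁰? φ) φ))

Cand₁⁻ : ℕ → ℕ → ℕ → ℕ → ℕ → Set
Cand₁⁻ φ x k R0 R1 = k < k′ φ × k ≤ ω φ x × IsR⁰ φ k R0 × IsR¹ φ (ω φ x ∸ k) R1

Bnd₁⁻ : ℕ → ℕ → ℕ → ℕ → Set
Bnd₁⁻ φ x R0 R1 = 1 + R0 ≤ x × 1 + R0 * R1 ≤ x ^ φ

Cand₁⁺ : ℕ → ℕ → ℕ → ℕ → ℕ → Set
Cand₁⁺ φ x k R0 R1 = k′ φ ≤ k × k < ω φ x × IsR⁰ φ (suc k) R0 × IsR¹ φ (ω φ x ∸ k) R1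

Bnd₁⁺ : ℕ → ℕ → ℕ → ℕ → Set
Bnd₁⁺ φ x R0 R1 = φ + R0 ≤ φ * x × φ + R0 * R1 ≤ φ * x ^ φ

-- Case φ ∣ x^φ - 1
-- k ∈ I⁻ with k ≥ 1 (so that R⁰_{k-1} is defined), R0 = R⁰_{k-1}, R1 = R¹_k
Cand₂⁻ : ℕ → ℕ → ℕ → ℕ → ℕ → Set
Cand₂⁻ φ x k R0 R1 = 1 ≤ k × k < k′ φ × k ≤ ω φ x × IsR⁰ φ (k ∸ 1) R0 × IsR¹ φ (ω φ x ∸ k) R1

Bnd₂⁻ : ℕ → ℕ → ℕ → ℕ → Set
Bnd₂⁻ φ x R0 R1 = 1 + φ * R0 ≤ x × 1 + φ * φ * R0 * R1 ≤ x ^ φ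

Cand₂⁺ : ℕ → ℕ → ℕ → ℕ → ℕ → Set
Cand₂⁺ φ x k R0 R1 = k′ φ ≤ k × k < ω φ x × IsR⁰ φ k R0 × IsR¹ φ (ω φ x ∸ k) R1

Bnd₂⁺ : ℕ → ℕ → ℕ → ℕ → Set
Bnd₂⁺ φ x R0 R1 = 1 + R0 ≤ x × 1 + φ * R0 * R1 ≤ x ^ φ

Nonempty₁ Nonempty₂ : ℕ → ℕ → Set
Nonempty₁ φ x = ∃ λ k → ∃ λ R0 → ∃ λ R1 → Cand₁⁻ φ x k R0 R1 ⊎ Cand₁⁺ φ x k R0 R1
Nonempty₂ φ x = ∃ λ k → ∃ λ R0 → ∃ λ R1 → Cand₂⁻ φ x k R0 R1 ⊎ Cand₂⁺ φ x k R0 R1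

-- x ≥ min of the (finite, nonempty) set of bounds  ⇔  x ≥ some admissible bound
GeMin₁ GeMin₂ : ℕ → ℕ → Set
GeMin₁ φ x = ∃ λ k → ∃ λ R0 → ∃ λ R1 →
  (Cand₁⁻ φ x k R0 R1 × Bnd₁⁻ φ x R0 R1) ⊎ (Cand₁⁺ φ x k R0 R1 × Bnd₁⁺ φ x R0 R1)
GeMin₂ φ x = ∃ λ k → ∃ λ R0 → ∃ λ R1 →
  (Cand₂⁻ φ x k R0 R1 × Bnd₂⁻ φ x R0 R1) ⊎ (Cand₂⁺ φ x k R0 R1 × Bnd₂⁺ φ x R0 R1)

{-# OPTIONS --safe #-}
-- Write x = 1 + y, so that N = x ^ φ ∸ 1 = y Φ with Φ = 1 + x + ⋯ + x ^ (φ ∸ 1) ≡ φ (mod y).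
-- If a prime q divides N but not y, then x has order φ modulo q, so q ≡ 1 (mod φ) by Fermat;
-- hence every prime factor of N in Π⁰ divides y. Let F⁰ and F¹ be the prime factors of N in
-- Π⁰ and Π¹ and k = |F⁰|, so that ω = k + |F¹|. As the k smallest elements of a set have the
-- least product among its k-element subsets, R⁰_k ≤ ∏ F⁰ ≤ y and R⁰_k R¹ ≤ ∏ F⁰ ∏ F¹ ≤ N.
-- When k ≥ k′ the index k is used in I⁺ instead: a prime factor of Φ other than φ lies in F¹,
-- so k < ω, and R⁰ is bounded through F⁰ ∪ {φ} when φ ∤ N, or through F⁰ ∖ {φ} when φ ∣ N
-- (then φ ∣ y, φ ∣ Φ and φ ∏ F ∣ N). For odd φ ∣ N such a prime factor of Φ exists because
-- Φ / φ ≡ 1 (mod φ); for φ = 2 the non-emptiness hypothesis gives k < ω.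
module Submission where

open import Defs
open import Data.Fin.Base using (Fin; zero; suc; toℕ; fromℕ; inject₁)
open import Data.Fin.Properties using (toℕ-fromℕ; toℕ-inject₁; toℕ<n)
open import Data.List.Base using (List; []; _∷_; [_]; _++_; filter; upTo; length)
open import Data.List.Membership.Propositional using (_∈_; lose)
open import Data.List.Membership.Propositional.Properties using (∈-upTo⁺)
open import Data.List.Properties
  using (filter-++; filter-accept; filter-reject; filter-none; filter-some; upTo-∷ʳ; length-++; ++-identityʳ)
open import Data.List.Relation.Binary.Permutation.Propositional
  using (_↭_; ↭-refl; ↭-prep; ↭-trans; ↭-sym; ↭-reflexive)
open import Data.List.Relation.Binary.Permutation.Propositional.Properties using (shift; ↭-length)
open import Data.List.Relation.Unary.All as All using (All; []; _∷_)
open import Data.List.Relation.Unary.All.Properties using (all-filter)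
open import Data.List.Relation.Unary.AllPairs using (AllPairs; []; _∷_)
import Data.List.Relation.Unary.AllPairs.Properties as AllPairs
open import Data.List.Relation.Unary.Any using (here; there)
open import Data.List.Relation.Unary.Unique.Propositional using (Unique)
import Data.List.Relation.Unary.Unique.Propositional.Properties as Unique
open import Data.Nat
open import Data.Nat.Combinatorics using (_C_; nCn≡1; nCk≡n!/k![n-k]!; k![n∸k]!∣n!)
open import Data.Nat.Coprimality using (Coprime; coprime-Bézout)
open import Data.Nat.DivMod using (_/_; m/n*n≡m)
open import Data.Nat.Divisibility
open import Data.Nat.GCD using (module Bézout)
open import Data.Nat.ListAction using (product)
open import Data.Nat.ListAction.Properties using (product-↭; product-++)
open import Data.Nat.Primality
open import Data.Nat.Primality.Factorisation using (factorise)
open import Data.Nat.Properties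
open import Data.Nat.Tactic.RingSolver using (solve-∀)
open import Data.Product using (∃; _×_; _,_; proj₁; proj₂)
open import Data.Sum using (_⊎_; inj₁; inj₂; [_,_]′)
open import Function.Base using (_∘_)
open import Level using (0ℓ)
open import Relation.Binary.Definitions using (DecidableEquality)
open import Relation.Binary.PropositionalEquality hiding ([_])
open import Relation.Nullary using (¬_; yes; no; contradiction)
open import Relation.Nullary.Decidable using (_×-dec_; _⊎-dec_; ¬?)
open import Relation.Unary using (Pred; Decidable; _⊆_)

import Algebra.Definitions.RawSemiring as RawSemiringDefinitions
import Algebra.Properties.CommutativeSemiring.Binomial as Binomial

prime⇒2≤ : ∀ {p} → Prime p → 2 ≤ p
prime⇒2≤ {p} pp = nonTrivial⇒n>1 p {{prime⇒nonTrivial pp}}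

prime∤1 : ∀ {p} → Prime p → ¬ p ∣ 1
prime∤1 pp p∣1 = ¬prime[1] (subst Prime (∣1⇒≡1 p∣1) pp)

prime∣prime⇒≡ : ∀ {p q} → Prime p → Prime q → p ∣ q → p ≡ q
prime∣prime⇒≡ pp pq p∣q with prime⇒irreducible pq p∣q
... | inj₁ refl = contradiction pp ¬prime[1]
... | inj₂ p≡q  = p≡q

prime∤⇒coprime : ∀ {p n} → Prime p → ¬ p ∣ n → Coprime p n
prime∤⇒coprime pp p∤n (d∣p , d∣n) with prime⇒irreducible pp d∣p
... | inj₁ d≡1  = d≡1
... | inj₂ refl = contradiction d∣n p∤n

prime∤product : ∀ {p qs} → Prime p → All Prime qs → All (p ≢_) qs → ¬ p ∣ product qs
prime∤product pp []         []           = prime∤1 pp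
prime∤product pp (pq ∷ pqs) (p≢q ∷ p≢qs) p∣q*Π with euclidsLemma _ _ pp p∣q*Π
... | inj₁ p∣q = p≢q (prime∣prime⇒≡ pp pq p∣q)
... | inj₂ p∣Π = prime∤product pp pqs p≢qs p∣Π

product-primes-∣ : ∀ {m ps} → All Prime ps → Unique ps → All (_∣ m) ps → product ps ∣ m
product-primes-∣ {m} [] [] [] = 1∣ m
product-primes-∣ {m} {p ∷ ps} (pp ∷ pps) (p≢ps ∷ unique) (p∣m ∷ ps∣m)
  with product-primes-∣ pps unique ps∣m
... | divides t m≡tΠ with euclidsLemma t (product ps) pp (subst (p ∣_) m≡tΠ p∣m)
...   | inj₁ p∣t = subst (p * product ps ∣_) (sym m≡tΠ) (*-monoˡ-∣ (product ps) p∣t)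
...   | inj₂ p∣Π = contradiction p∣Π (prime∤product pp pps p≢ps)

∃-prime-divisor : ∀ {n} → 2 ≤ n → ∃ λ q → Prime q × q ∣ n
∃-prime-divisor {n@(suc _)} 2≤n with factorise n
... | record { factors = [] ; isFactorisation = n≡1 } = contradiction n≡1 (>⇒≢ 2≤n)
... | record { factors = q ∷ qs ; isFactorisation = n≡qΠ ; factorsPrime = pq ∷ _ } =
  q , pq , divides (product qs) (trans n≡qΠ (*-comm q _))

even⊎odd : ∀ n → ∃ λ h → n ≡ h + h ⊎ n ≡ suc (h + h)
even⊎odd zero          = 0 , inj₁ refl
even⊎odd (suc zero)    = 0 , inj₂ refl
even⊎odd (suc (suc n)) with even⊎odd n
... | h , inj₁ refl = suc h , inj₁ (cong suc (sym (+-suc h h)))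
... | h , inj₂ refl = suc h , inj₂ (cong (λ m → suc (suc m)) (sym (+-suc h h)))

2∣h+h : ∀ h → 2 ∣ h + h
2∣h+h h = divides h (sym (trans (*-comm h 2) (cong (h +_) (+-identityʳ h))))

prime≡2⊎odd : ∀ {p} → Prime p → p ≡ 2 ⊎ ∃ λ h → p ≡ suc (h + h) × 1 ≤ h
prime≡2⊎odd {p} pp with even⊎odd p
... | h     , inj₁ p≡h+h = inj₁ (sym (prime∣prime⇒≡ prime[2] pp (subst (2 ∣_) (sym p≡h+h) (2∣h+h h))))
... | zero  , inj₂ refl  = contradiction pp ¬prime[1]
... | suc h , inj₂ p≡    = inj₂ (suc h , p≡ , s≤s z≤n)

infix 4 _≡1-mod_
record _≡1-mod_ (a q : ℕ) : Set where
  constructor congruence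
  field
    multiple : ℕ
    equality : a ≡ 1 + q * multiple

geom : ℕ → ℕ → ℕ
geom y zero    = 0
geom y (suc n) = 1 + suc y * geom y n

suc^≡1+*geom : ∀ y n → suc y ^ n ≡ 1 + y * geom y n
suc^≡1+*geom y zero    = cong suc (sym (*-zeroʳ y))
suc^≡1+*geom y (suc n) = begin
  suc y * suc y ^ n           ≡⟨ cong (suc y *_) (suc^≡1+*geom y n) ⟩
  suc y * (1 + y * geom y n)  ≡⟨ horner y (geom y n) ⟩
  1 + y * geom y (suc n)      ∎
  where
  open ≡-Reasoning
  horner : ∀ y g → suc y * (1 + y * g) ≡ 1 + y * (1 + suc y * g)
  horner = solve-∀

^-≡1-mod : ∀ {q a} n → a ≡1-mod q → a ^ n ≡1-mod q
^-≡1-mod {q} n (congruence s refl) =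
  congruence (s * geom (q * s) n) (trans (suc^≡1+*geom (q * s) n) (cong suc (*-assoc q s _)))

^*-≡1-mod : ∀ {q a} m k → a ^ m ≡1-mod q → a ^ (k * m) ≡1-mod q
^*-≡1-mod {q} {a} m k aᵐ≡1 =
  subst (_≡1-mod q) (trans (^-*-assoc a m k) (cong (a ^_) (*-comm m k))) (^-≡1-mod k aᵐ≡1)

≡1-mod⇒∤ : ∀ {q a} → Prime q → a ≡1-mod q → ¬ q ∣ a
≡1-mod⇒∤ {q} pq (congruence s refl) q∣a =
  prime∤1 pq (∣m+n∣m⇒∣n (subst (q ∣_) (+-comm 1 (q * s)) q∣a) (m∣m*n {q} s))

-- Modulo q: x ≡ x * x ^ e = x ^ (1 + e) ≡ 1.
^-suc-≡1-mod⇒∣ : ∀ {q y e e′} → 1 + e ≡ e′ → suc y ^ e ≡1-mod q → suc y ^ e′ ≡1-mod q → q ∣ y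
^-suc-≡1-mod⇒∣ {q} {y} {e} refl (congruence s xᵉ≡) (congruence t x¹⁺ᵉ≡) =
  ∣m+n∣m⇒∣n (divides t q[1+y]s+y≡tq) (m∣m*n (suc y * s))
  where
  open ≡-Reasoning
  expand : ∀ q y s → 1 + (q * (suc y * s) + y) ≡ suc y * (1 + q * s)
  expand = solve-∀
  q[1+y]s+y≡tq : q * (suc y * s) + y ≡ t * q
  q[1+y]s+y≡tq = suc-injective (begin
    1 + (q * (suc y * s) + y)  ≡⟨ expand q y s ⟩
    suc y * (1 + q * s)        ≡⟨ cong (suc y *_) xᵉ≡ ⟨
    suc y * suc y ^ e          ≡⟨ x¹⁺ᵉ≡ ⟩
    1 + q * t                  ≡⟨ cong suc (*-comm q t) ⟩
    1 + t * q                  ∎)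

coprime-exponents-≡1-mod⇒∣ : ∀ {q y m n} → Coprime m n →
                             suc y ^ m ≡1-mod q → suc y ^ n ≡1-mod q → q ∣ y
coprime-exponents-≡1-mod⇒∣ {m = m} {n} m⊥n xᵐ≡1 xⁿ≡1 with coprime-Bézout m⊥n
... | Bézout.+- a b 1+bn≡am = ^-suc-≡1-mod⇒∣ 1+bn≡am (^*-≡1-mod n b xⁿ≡1) (^*-≡1-mod m a xᵐ≡1)
... | Bézout.-+ a b 1+am≡bn = ^-suc-≡1-mod⇒∣ 1+am≡bn (^*-≡1-mod m a xᵐ≡1) (^*-≡1-mod n b xⁿ≡1)

open RawSemiringDefinitions +-*-rawSemiring using (sum) renaming (_×_ to _×ₐ_; _^_ to _^ₐ_)
module ℕ-Binomial = Binomial +-*-commutativeSemiring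

×ₐ≡* : ∀ n x → n ×ₐ x ≡ n * x
×ₐ≡* zero    x = refl
×ₐ≡* (suc n) x = cong (x +_) (×ₐ≡* n x)

^ₐ≡^ : ∀ x n → x ^ₐ n ≡ x ^ n
^ₐ≡^ x zero    = refl
^ₐ≡^ x (suc n) = cong (x *_) (^ₐ≡^ x n)

sum-init-divisible : ∀ {d} n (h : Fin (suc n) → ℕ) → (∀ j → d ∣ h (inject₁ j)) →
                     ∃ λ m → sum h ≡ d * m + h (fromℕ n)
sum-init-divisible {d} zero    h _  = 0 , trans (+-identityʳ (h zero)) (cong (_+ h zero) (sym (*-zeroʳ d)))
sum-init-divisible {d} (suc n) h d∣ with sum-init-divisible n (h ∘ suc) (d∣ ∘ suc) | d∣ zero
... | m , ∑≡ | divides a h₀≡ = a + m , (begin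
  h zero + sum (h ∘ suc)               ≡⟨ cong₂ _+_ h₀≡ ∑≡ ⟩
  a * d + (d * m + h (fromℕ (suc n)))  ≡⟨ regroup a d m _ ⟩
  d * (a + m) + h (fromℕ (suc n))      ∎)
  where
  open ≡-Reasoning
  regroup : ∀ a d m z → a * d + (d * m + z) ≡ d * (a + m) + z
  regroup = solve-∀

p∤m! : ∀ {p} → Prime p → ∀ {m} → m < p → ¬ p ∣ m !
p∤m! pp {zero}  _   = prime∤1 pp
p∤m! pp {suc m} m<p p∣m! with euclidsLemma (suc m) (m !) pp p∣m!
... | inj₁ p∣1+m = <⇒≱ m<p (∣⇒≤ p∣1+m)
... | inj₂ p∣m!  = p∤m! pp (<-trans (n<1+n m) m<p) p∣m!

p∣pCi : ∀ {p i} → Prime p → 0 < i → i < p → p ∣ p C i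
p∣pCi {p@(suc p′)} {i} pp 0<i i<p
  with euclidsLemma (p C i) (i ! * (p ∸ i) !) pp (subst (p ∣_) p!≡pCi*i![p∸i]! (m∣m*n (p′ !)))
  where
  open ≡-Reasoning
  instance _ = i !* (p ∸ i) !≢0
  p!≡pCi*i![p∸i]! : p ! ≡ (p C i) * (i ! * (p ∸ i) !)
  p!≡pCi*i![p∸i]! = begin
    p !                                          ≡⟨ m/n*n≡m (k![n∸k]!∣n! (<⇒≤ i<p)) ⟨
    p ! / (i ! * (p ∸ i) !) * (i ! * (p ∸ i) !)  ≡⟨ cong (_* (i ! * (p ∸ i) !)) (nCk≡n!/k![n-k]! (<⇒≤ i<p)) ⟨
    (p C i) * (i ! * (p ∸ i) !)                  ∎
... | inj₁ p∣pCi = p∣pCi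
... | inj₂ p∣i![p∸i]! with euclidsLemma (i !) ((p ∸ i) !) pp p∣i![p∸i]!
...   | inj₁ p∣i!     = contradiction p∣i! (p∤m! pp i<p)
...   | inj₂ p∣[p∸i]! = contradiction p∣[p∸i]! (p∤m! pp (∸-monoʳ-< 0<i (<⇒≤ i<p)))

[1+x]^p≡x^p+1-mod : ∀ {p} → Prime p → ∀ x → ∃ λ m → suc x ^ p ≡ x ^ p + p * m + 1
[1+x]^p≡x^p+1-mod {p@(suc p′)} pp x with sum-init-divisible p′ (term ∘ suc) inner-divisible
  where
  term : Fin (suc p) → ℕ
  term = ℕ-Binomial.binomialTerm 1 x p
  inner-divisible : ∀ j → p ∣ term (suc (inject₁ j))
  inner-divisible j = subst (p ∣_) (sym (×ₐ≡* (p C suc (toℕ (inject₁ j))) _))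
    (∣m⇒∣m*n _ (p∣pCi pp (s≤s z≤n) (s≤s (subst (_< p′) (sym (toℕ-inject₁ j)) (toℕ<n j)))))
... | m , ∑≡ = m , (begin
  suc x ^ p                         ≡⟨ ^ₐ≡^ (suc x) p ⟨
  suc x ^ₐ p                        ≡⟨ ℕ-Binomial.theorem p 1 x ⟩
  term zero + sum (term ∘ suc)      ≡⟨ cong₂ _+_ first-term ∑≡ ⟩
  x ^ p + (p * m + term (fromℕ p))  ≡⟨ cong (λ t → x ^ p + (p * m + t)) last-term ⟩
  x ^ p + (p * m + 1)               ≡⟨ +-assoc (x ^ p) (p * m) 1 ⟨
  x ^ p + p * m + 1                 ∎)
  where
  open ≡-Reasoning
  term : Fin (suc p) → ℕ
  term = ℕ-Binomial.binomialTerm 1 x p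
  first-term : term zero ≡ x ^ p
  first-term = begin
    1 ×ₐ (1 * x ^ₐ p)  ≡⟨ ×ₐ≡* 1 _ ⟩
    1 * (1 * x ^ₐ p)   ≡⟨ trans (*-identityˡ _) (*-identityˡ _) ⟩
    x ^ₐ p             ≡⟨ ^ₐ≡^ x p ⟩
    x ^ p              ∎
  last-term : term (fromℕ p) ≡ 1
  last-term = begin
    (p C toℕ (fromℕ p)) ×ₐ (1 ^ₐ toℕ (fromℕ p) * x ^ₐ (p ∸ toℕ (fromℕ p)))
      ≡⟨ cong (λ k → (p C k) ×ₐ (1 ^ₐ k * x ^ₐ (p ∸ k))) (toℕ-fromℕ p) ⟩
    (p C p) ×ₐ (1 ^ₐ p * x ^ₐ (p ∸ p))  ≡⟨ ×ₐ≡* (p C p) _ ⟩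
    (p C p) * (1 ^ₐ p * x ^ₐ (p ∸ p))   ≡⟨ cong₂ (λ c k → c * (1 ^ₐ p * x ^ₐ k)) (nCn≡1 p) (n∸n≡0 p) ⟩
    1 * (1 ^ₐ p * 1)                    ≡⟨ trans (*-identityˡ _) (*-identityʳ _) ⟩
    1 ^ₐ p                              ≡⟨ trans (^ₐ≡^ 1 p) (^-zeroˡ p) ⟩
    1                                   ∎

fermat : ∀ {p} → Prime p → ∀ x → ∃ λ s → x ^ p ≡ x + p * s
fermat {suc p′} pp zero    = 0 , sym (*-zeroʳ (suc p′))
fermat {p}      pp (suc x) with fermat pp x | [1+x]^p≡x^p+1-mod pp x
... | s , xᵖ≡ | m , [1+x]ᵖ≡ = s + m , (begin
  suc x ^ p              ≡⟨ [1+x]ᵖ≡ ⟩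
  x ^ p + p * m + 1      ≡⟨ cong (λ t → t + p * m + 1) xᵖ≡ ⟩
  x + p * s + p * m + 1  ≡⟨ regroup x p s m ⟩
  suc x + p * (s + m)    ∎)
  where
  open ≡-Reasoning
  regroup : ∀ x p s m → x + p * s + p * m + 1 ≡ suc x + p * (s + m)
  regroup = solve-∀

fermat-little : ∀ {p x} → Prime p → ¬ p ∣ x → x ^ (p ∸ 1) ≡1-mod p
fermat-little {p@(suc p′)} {x} pp p∤x with x ^ p′ in xᵖ⁻¹≡ | fermat pp x
... | zero  | _ = contradiction (subst (p ∣_) (sym (m^n≡0⇒m≡0 x p′ xᵖ⁻¹≡)) (p ∣0)) p∤x
... | suc u | s , x[1+u]≡ with euclidsLemma x u pp (divides s xu≡sp)
  where
  open ≡-Reasoning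
  xu≡sp : x * u ≡ s * p
  xu≡sp = +-cancelˡ-≡ x _ _ (begin
    x + x * u  ≡⟨ *-suc x u ⟨
    x * suc u  ≡⟨ x[1+u]≡ ⟩
    x + p * s  ≡⟨ cong (x +_) (*-comm p s) ⟩
    x + s * p  ∎)
...   | inj₁ p∣x = contradiction p∣x p∤x
...   | inj₂ p∣u = congruence (quotient p∣u) (cong suc (m∣n⇒n≡m*quotient p∣u))

-- The order of x modulo q is the prime φ, and it divides q - 1 by Fermat.
prime-order∣q∸1 : ∀ {φ q y} → Prime φ → Prime q → suc y ^ φ ≡1-mod q → ¬ q ∣ y → φ ∣ q ∸ 1
prime-order∣q∸1 {φ@(suc φ′)} {q} {y} pφ pq xᵠ≡1 q∤y with φ ∣? q ∸ 1
... | yes φ∣q∸1 = φ∣q∸1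
... | no  φ∤q∸1 =
  contradiction (coprime-exponents-≡1-mod⇒∣ (prime∤⇒coprime pφ φ∤q∸1) xᵠ≡1 xᵠ⁻¹≡1) q∤y
  where
  xᵠ⁻¹≡1 : suc y ^ (q ∸ 1) ≡1-mod q
  xᵠ⁻¹≡1 = fermat-little pq (λ q∣x → ≡1-mod⇒∤ pq xᵠ≡1 (∣m⇒∣m*n (suc y ^ φ′) q∣x))

triangle : ℕ → ℕ
triangle zero    = 0
triangle (suc n) = n + triangle n

triangle-odd : ∀ h → triangle (suc (h + h)) ≡ h * suc (h + h)
triangle-odd zero    = refl
triangle-odd (suc h) rewrite +-suc h h = begin
  suc (suc (h + h)) + (suc (h + h) + triangle (suc (h + h)))
    ≡⟨ cong (λ t → suc (suc (h + h)) + (suc (h + h) + t)) (triangle-odd h) ⟩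
  suc (suc (h + h)) + (suc (h + h) + h * suc (h + h))  ≡⟨ expand h ⟩
  suc h * suc (suc (suc (h + h)))                      ∎
  where
  open ≡-Reasoning
  expand : ∀ h → suc (suc (h + h)) + (suc (h + h) + h * suc (h + h)) ≡ suc h * suc (suc (suc (h + h)))
  expand = solve-∀

geom-expansion : ∀ y n → ∃ λ c → geom y n ≡ n + y * (triangle n + y * c)
geom-expansion y zero    = 0 , zeros y
  where
  zeros : ∀ y → 0 ≡ 0 + y * (0 + y * 0)
  zeros = solve-∀
geom-expansion y (suc n) with geom-expansion y n
... | c , g≡ = c + triangle n + y * c , (begin
  1 + suc y * geom y n                                          ≡⟨ cong (λ g → 1 + suc y * g) g≡ ⟩
  1 + suc y * (n + y * (triangle n + y * c))                    ≡⟨ expand y n (triangle n) c ⟩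
  suc n + y * (n + triangle n + y * (c + triangle n + y * c))   ∎)
  where
  open ≡-Reasoning
  expand : ∀ y n t c → 1 + suc y * (n + y * (t + y * c)) ≡ suc n + y * (n + t + y * (c + t + y * c))
  expand = solve-∀

geom-odd : ∀ {φ h y a} → φ ≡ suc (h + h) → y ≡ φ * a →
           ∃ λ c → geom y φ ≡ φ * (1 + φ * (a * h + a * a * c))
geom-odd {h = h} {a = a} refl refl with geom-expansion (suc (h + h) * a) (suc (h + h))
... | c , g≡ = c , (begin
  geom (φ * a) φ                        ≡⟨ g≡ ⟩
  φ + φ * a * (triangle φ + φ * a * c)  ≡⟨ cong (λ t → φ + φ * a * (t + φ * a * c)) (triangle-odd h) ⟩
  φ + φ * a * (h * φ + φ * a * c)       ≡⟨ factor φ a h c ⟩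
  φ * (1 + φ * (a * h + a * a * c))     ∎)
  where
  open ≡-Reasoning
  φ = suc (h + h)
  factor : ∀ φ a h c → φ + φ * a * (h * φ + φ * a * c) ≡ φ * (1 + φ * (a * h + a * a * c))
  factor = solve-∀

module _ {a p q r} {A : Set a} {P : Pred A p} {Q : Pred A q} {R : Pred A r}
         (P? : Decidable P) (Q? : Decidable Q) (R? : Decidable R)
         (P⇒Q⊎R : ∀ {x} → P x → Q x ⊎ R x) (Q⊆P : Q ⊆ P) (R⊆P : R ⊆ P)
         (Q⇒¬R : ∀ {x} → Q x → ¬ R x)
         where

  filter-⊎-↭ : ∀ xs → filter P? xs ↭ filter Q? xs ++ filter R? xs
  filter-⊎-↭ []       = ↭-refl
  filter-⊎-↭ (x ∷ xs) with Q? x | R? x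
  ... | yes Qx | yes Rx = contradiction Rx (Q⇒¬R Qx)
  ... | yes Qx | no  _  = ↭-trans (↭-reflexive (filter-accept P? (Q⊆P Qx))) (↭-prep x (filter-⊎-↭ xs))
  ... | no  _  | yes Rx = ↭-trans (↭-reflexive (filter-accept P? (R⊆P Rx)))
    (↭-trans (↭-prep x (filter-⊎-↭ xs)) (↭-sym (shift x (filter Q? xs) (filter R? xs))))
  ... | no ¬Qx | no ¬Rx =
    ↭-trans (↭-reflexive (filter-reject P? ([ ¬Qx , ¬Rx ]′ ∘ P⇒Q⊎R))) (filter-⊎-↭ xs)

module _ {a} {A : Set a} (_≟_ : DecidableEquality A) where

  filter-≟-unique : ∀ {x xs} → Unique xs → x ∈ xs → filter (_≟ x) xs ≡ [ x ]
  filter-≟-unique {x} (x≢xs ∷ _) (here refl) = trans (filter-accept (_≟ x) refl)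
    (cong (x ∷_) (filter-none (_≟ x) (All.map (λ x≢y y≡x → x≢y (sym y≡x)) x≢xs)))
  filter-≟-unique {x} (y≢xs ∷ unique) (there x∈xs) =
    trans (filter-reject (_≟ x) (All.lookup y≢xs x∈xs)) (filter-≟-unique unique x∈xs)

  filter-insert-↭ : ∀ {p q} {P : Pred A p} {Q : Pred A q} (P? : Decidable P) (Q? : Decidable Q) {x xs} →
    Unique xs → x ∈ xs → P x → ¬ Q x → (∀ {y} → P y → y ≡ x ⊎ Q y) → Q ⊆ P →
    filter P? xs ↭ x ∷ filter Q? xs
  filter-insert-↭ {Q = Q} P? Q? {x} {xs} unique x∈xs Px ¬Qx P⇒≡x⊎Q Q⊆P = ↭-trans
    (filter-⊎-↭ P? (_≟ x) Q? P⇒≡x⊎Q (λ { refl → Px }) Q⊆P (λ { refl Qx → ¬Qx Qx }) xs)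
    (↭-reflexive (cong (_++ filter Q? xs) (filter-≟-unique unique x∈xs)))

unique-constant⇒length≤1 : ∀ {c : ℕ} {xs} → Unique xs → All (_≡ c) xs → length xs ≤ 1
unique-constant⇒length≤1 []                  []                = z≤n
unique-constant⇒length≤1 (_ ∷ [])            (_ ∷ [])          = s≤s z≤n
unique-constant⇒length≤1 ((x≢y ∷ _) ∷ _ ∷ _) (refl ∷ refl ∷ _) = contradiction refl x≢y

module _ {P : Pred ℕ 0ℓ} (P? : Decidable P) where

  below-suc : ∀ n → below P? (suc n) ≡ below P? n ++ filter P? [ n ]
  below-suc n = trans (cong (filter P?) (sym (upTo-∷ʳ n))) (filter-++ P? (upTo n) [ n ])

  below-suc-accept : ∀ {n} → P n → below P? (suc n) ≡ below P? n ++ [ n ]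
  below-suc-accept {n} Pn = trans (below-suc n) (cong (below P? n ++_) (filter-accept P? Pn))

  below-suc-reject : ∀ {n} → ¬ P n → below P? (suc n) ≡ below P? n
  below-suc-reject {n} ¬Pn =
    trans (below-suc n) (trans (cong (below P? n ++_) (filter-reject P? ¬Pn)) (++-identityʳ _))

  below-next : ∀ {n l} → n ≤‴ l → P l → ∃ λ r → r ≤ l × below P? (suc r) ≡ below P? n ++ [ r ]
  below-next {n} n≤l Pl with P? n
  ... | yes Pn = n , ≤‴⇒≤ n≤l , below-suc-accept Pn
  below-next ≤‴-refl       Pl | no ¬Pn = contradiction Pl ¬Pn
  below-next (≤‴-step n<l) Pl | no ¬Pn with below-next n<l Pl
  ... | r , r≤l , below[1+r]≡ = r , r≤l , trans below[1+r]≡ (cong (_++ [ r ]) (below-suc-reject ¬Pn))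

  -- Exchange argument: the i-th element of P above n is at most the i-th element of L.
  below-extend-≤ : ∀ n {L} → All (n ≤_) L → AllPairs _<_ L → All P L →
    ∃ λ m → length (below P? m) ≡ length (below P? n) + length L
          × product (below P? m) ≤ product (below P? n) * product L
  below-extend-≤ n {[]} _ _ _ = n , sym (+-identityʳ _) , ≤-reflexive (sym (*-identityʳ _))
  below-extend-≤ n {l ∷ L} (n≤l ∷ _) (l< ∷ sorted) (Pl ∷ PL) with below-next (≤⇒≤‴ n≤l) Pl
  ... | r , r≤l , below[1+r]≡ with below-extend-≤ (suc r) (All.map (≤-<-trans r≤l) l<) sorted PL
  ... | m , length≡ , product≤ = m , length-eq , product-le
    where
    Bₙ = below P? n
    length-eq : length (below P? m) ≡ length Bₙ + suc (length L)
    length-eq = begin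
      length (below P? m)                   ≡⟨ length≡ ⟩
      length (below P? (suc r)) + length L  ≡⟨ cong (λ xs → length xs + length L) below[1+r]≡ ⟩
      length (Bₙ ++ [ r ]) + length L       ≡⟨ cong (_+ length L) (length-++ Bₙ) ⟩
      length Bₙ + 1 + length L              ≡⟨ +-assoc (length Bₙ) 1 (length L) ⟩
      length Bₙ + suc (length L)            ∎
      where open ≡-Reasoning
    product-le : product (below P? m) ≤ product Bₙ * (l * product L)
    product-le = begin
      product (below P? m)                    ≤⟨ product≤ ⟩
      product (below P? (suc r)) * product L  ≡⟨ cong (λ xs → product xs * product L) below[1+r]≡ ⟩
      product (Bₙ ++ [ r ]) * product L       ≡⟨ cong (_* product L) (product-++ Bₙ [ r ]) ⟩
      product Bₙ * (r * 1) * product L        ≡⟨ cong (λ t → product Bₙ * t * product L) (*-identityʳ r) ⟩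
      product Bₙ * r * product L              ≡⟨ *-assoc (product Bₙ) r (product L) ⟩
      product Bₙ * (r * product L)            ≤⟨ *-monoʳ-≤ (product Bₙ) (*-monoˡ-≤ (product L) r≤l) ⟩
      product Bₙ * (l * product L)            ∎
      where open ≤-Reasoning

  prefixProd-≤ : ∀ {L} → AllPairs _<_ L → All P L → ∃ λ R → IsPrefixProd P? (length L) R × R ≤ product L
  prefixProd-≤ {L} sorted PL with below-extend-≤ 0 (All.tabulate (λ _ → z≤n)) sorted PL
  ... | m , length≡ , product≤ =
    product (below P? m) , (m , length≡ , refl) , subst (_ ≤_) (+-identityʳ (product L)) product≤

  prefixProd-≤-filter : ∀ {Q : Pred ℕ 0ℓ} (Q? : Decidable Q) → Q ⊆ P → ∀ n →
    ∃ λ R → IsPrefixProd P? (length (filter Q? (upTo n))) R × R ≤ product (filter Q? (upTo n))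
  prefixProd-≤-filter Q? Q⊆P n = prefixProd-≤
    (AllPairs.filter⁺ Q? (AllPairs.applyUpTo⁺₁ (λ i → i) n (λ i<j _ → i<j)))
    (All.map Q⊆P (all-filter Q? (upTo n)))

prime∈Π⁰ : ∀ {p} → Prime p → Π⁰ p p
prime∈Π⁰ {0}               pp = contradiction pp ¬prime[0]
prime∈Π⁰ {1}               pp = contradiction pp ¬prime[1]
prime∈Π⁰ {p@(suc (suc _))} pp = pp , >⇒∤ (n<1+n (p ∸ 1))

Π⁰[2]⇒≡2 : ∀ {p} → Π⁰ 2 p → p ≡ 2
Π⁰[2]⇒≡2 (pp , 2∤p∸1) with prime≡2⊎odd pp
... | inj₁ p≡2            = p≡2
... | inj₂ (h , refl , _) = contradiction (2∣h+h h) 2∤p∸1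
module PrimeFactors (φ y : ℕ) .{{_ : NonZero y}} (pφ : Prime φ) where

  x N Φ : ℕ
  x = suc y
  N = x ^ φ ∸ 1
  Φ = geom y φ

  N≡yΦ : N ≡ y * Φ
  N≡yΦ = cong (_∸ 1) (suc^≡1+*geom y φ)

  x^φ≡1+N : x ^ φ ≡ 1 + N
  x^φ≡1+N = trans (suc^≡1+*geom y φ) (cong suc (sym N≡yΦ))

  Φ≡φ+y*d : ∃ λ d → Φ ≡ φ + y * d
  Φ≡φ+y*d = let c , Φ≡ = geom-expansion y φ in triangle φ + y * c , Φ≡

  φ≤Φ : φ ≤ Φ
  φ≤Φ = let d , Φ≡ = Φ≡φ+y*d in subst (φ ≤_) (sym Φ≡) (m≤m+n φ (y * d))

  Φ≤N : Φ ≤ N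
  Φ≤N = subst (Φ ≤_) (sym N≡yΦ) (m≤n*m Φ y)

  2≤Φ : 2 ≤ Φ
  2≤Φ = ≤-trans (prime⇒2≤ pφ) φ≤Φ

  instance
    Φ≢0 : NonZero Φ
    Φ≢0 = >-nonZero (≤-trans (s≤s z≤n) 2≤Φ)
    N≢0 : NonZero N
    N≢0 = subst NonZero (sym N≡yΦ) (m*n≢0 y Φ)

  ∣Φ⇒∣N : ∀ {q} → q ∣ Φ → q ∣ N
  ∣Φ⇒∣N {q} q∣Φ = subst (q ∣_) (sym N≡yΦ) (∣n⇒∣m*n y q∣Φ)

  ∣y⇒∣Φ⇒∣φ : ∀ {q} → q ∣ y → q ∣ Φ → q ∣ φ
  ∣y⇒∣Φ⇒∣φ q∣y q∣Φ = let d , Φ≡ = Φ≡φ+y*d in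
    ∣m+n∣m⇒∣n (subst (_ ∣_) (trans Φ≡ (+-comm φ (y * d))) q∣Φ) (∣m⇒∣m*n d q∣y)

  ∣N⇒x^φ≡1-mod : ∀ {p} → p ∣ N → x ^ φ ≡1-mod p
  ∣N⇒x^φ≡1-mod {p} (divides t N≡tp) = congruence t (trans x^φ≡1+N (cong suc (trans N≡tp (*-comm t p))))

  ∣N⇒∈U : ∀ {p} → p ∣ N → p ∈ upTo (suc N)
  ∣N⇒∈U p∣N = ∈-upTo⁺ (s≤s (∣⇒≤ p∣N))

  φ∈U : φ ∈ upTo (suc N)
  φ∈U = ∈-upTo⁺ (s≤s (≤-trans φ≤Φ Φ≤N))

  Π⁰∧∣N⇒∣y : ∀ {p} → Π⁰ φ p → p ∣ N → p ∣ y
  Π⁰∧∣N⇒∣y {p} (pp , φ∤p∸1) p∣N with p ∣? y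
  ... | yes p∣y = p∣y
  ... | no  p∤y = contradiction (prime-order∣q∸1 pφ pp (∣N⇒x^φ≡1-mod p∣N) p∤y) φ∤p∸1

  -- D? is spelled out as in the definition of ω, so that ω φ x is length F by definition.
  D? : Decidable (λ p → Prime p × p ∣ N)
  D? p = prime? p ×-dec (p ∣? N)
  D⁰? : Decidable (λ p → Π⁰ φ p × p ∣ N)
  D⁰? p = Π⁰? φ p ×-dec (p ∣? N)
  D¹? : Decidable (λ p → Π¹ φ p × p ∣ N)
  D¹? p = Π¹? φ p ×-dec (p ∣? N)

  U F F⁰ F¹ : List ℕ
  U  = upTo (suc N)
  F  = filter D? U
  F⁰ = filter D⁰? U
  F¹ = filter D¹? U

  k : ℕ
  k = length F⁰

  F↭F⁰++F¹ : F ↭ F⁰ ++ F¹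
  F↭F⁰++F¹ = filter-⊎-↭ D? D⁰? D¹? classify
    (λ ((pp , _) , p∣N) → pp , p∣N) (λ ((pp , _) , p∣N) → pp , p∣N)
    (λ ((_ , φ∤p∸1) , _) ((_ , φ∣p∸1) , _) → φ∤p∸1 φ∣p∸1) U
    where
    classify : ∀ {p} → Prime p × p ∣ N → Π⁰ φ p × p ∣ N ⊎ Π¹ φ p × p ∣ N
    classify {p} (pp , p∣N) with φ ∣? p ∸ 1
    ... | yes φ∣p∸1 = inj₂ ((pp , φ∣p∸1) , p∣N)
    ... | no  φ∤p∸1 = inj₁ ((pp , φ∤p∸1) , p∣N)

  ω≡k+|F¹| : ω φ x ≡ k + length F¹
  ω≡k+|F¹| = trans (↭-length F↭F⁰++F¹) (length-++ F⁰)

  ∏F≡∏F⁰*∏F¹ : product F ≡ product F⁰ * product F¹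
  ∏F≡∏F⁰*∏F¹ = trans (product-↭ F↭F⁰++F¹) (product-++ F⁰ F¹)

  k≤ω : k ≤ ω φ x
  k≤ω = subst (k ≤_) (sym ω≡k+|F¹|) (m≤m+n k (length F¹))

  prime-divisor-of-Φ⇒k<ω : ∀ {q} → Prime q → q ∣ Φ → q ≢ φ → k < ω φ x
  prime-divisor-of-Φ⇒k<ω {q} pq q∣Φ q≢φ =
    subst (k <_) (sym ω≡k+|F¹|) (m<m+n k (filter-some D¹? (lose (∣N⇒∈U q∣N) ((pq , φ∣q∸1) , q∣N))))
    where
    q∣N : q ∣ N
    q∣N = ∣Φ⇒∣N q∣Φ
    q∤y : ¬ q ∣ y
    q∤y q∣y = q≢φ (prime∣prime⇒≡ pq pφ (∣y⇒∣Φ⇒∣φ q∣y q∣Φ))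
    φ∣q∸1 : φ ∣ q ∸ 1
    φ∣q∸1 = prime-order∣q∸1 pφ pq (∣N⇒x^φ≡1-mod q∣N) q∤y

  product-filter-∣ : ∀ {Q : Pred ℕ 0ℓ} (Q? : Decidable Q) {m} →
                     (∀ {p} → Q p → Prime p) → (∀ {p} → Q p → p ∣ m) → product (filter Q? U) ∣ m
  product-filter-∣ Q? Q⇒prime Q⇒∣m = product-primes-∣ (All.map Q⇒prime (all-filter Q? U))
    (Unique.filter⁺ Q? (Unique.upTo⁺ (suc N))) (All.map Q⇒∣m (all-filter Q? U))

  ∏F⁰≤y : product F⁰ ≤ y
  ∏F⁰≤y = ∣⇒≤ (product-filter-∣ D⁰? (proj₁ ∘ proj₁) (λ (p⁰ , p∣N) → Π⁰∧∣N⇒∣y p⁰ p∣N))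

  ∏F≤N : product F ≤ N
  ∏F≤N = ∣⇒≤ (product-filter-∣ D? proj₁ proj₂)

  R⁰-bound : ∃ λ R → IsR⁰ φ k R × R ≤ product F⁰
  R⁰-bound = prefixProd-≤-filter (Π⁰? φ) D⁰? proj₁ (suc N)

  R¹-bound : ∃ λ R → IsR¹ φ (ω φ x ∸ k) R × R ≤ product F¹
  R¹-bound with prefixProd-≤-filter (Π¹? φ) D¹? proj₁ (suc N)
  ... | R , isR , R≤ = R , subst (λ j → IsR¹ φ j R) (sym ω∸k≡|F¹|) isR , R≤
    where
    ω∸k≡|F¹| : ω φ x ∸ k ≡ length F¹
    ω∸k≡|F¹| = trans (cong (_∸ k) ω≡k+|F¹|) (m+n∸m≡n k (length F¹))

  *-mono-∏F : ∀ {a b} → a ≤ product F⁰ → b ≤ product F¹ → a * b ≤ product F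
  *-mono-∏F a≤ b≤ = subst (_ ≤_) (sym ∏F≡∏F⁰*∏F¹) (*-mono-≤ a≤ b≤)

  ≤N⇒<x^φ : ∀ {a} → a ≤ N → 1 + a ≤ x ^ φ
  ≤N⇒<x^φ a≤N = subst (1 + _ ≤_) (sym x^φ≡1+N) (s≤s a≤N)

  φ+-mono-≤ : ∀ {a b} → a ≤ φ * b → φ + a ≤ φ * suc b
  φ+-mono-≤ {a} {b} a≤φb = subst (φ + a ≤_) (sym (*-suc φ b)) (+-monoʳ-≤ φ a≤φb)

  module NotDivisible (φ∤N : ¬ φ ∣ N) where

    k<ω : k < ω φ x
    k<ω with ∃-prime-divisor 2≤Φ
    ... | q , pq , q∣Φ =
      prime-divisor-of-Φ⇒k<ω pq q∣Φ (λ q≡φ → φ∤N (subst (_∣ N) q≡φ (∣Φ⇒∣N q∣Φ)))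

    D⁰₊? : Decidable (λ p → Π⁰ φ p × (p ∣ N ⊎ p ≡ φ))
    D⁰₊? p = Π⁰? φ p ×-dec ((p ∣? N) ⊎-dec (p ≟ φ))

    R⁰₊-bound : ∃ λ R → IsR⁰ φ (suc k) R × R ≤ φ * product F⁰
    R⁰₊-bound with prefixProd-≤-filter (Π⁰? φ) D⁰₊? proj₁ (suc N)
    ... | R , isR , R≤ =
      R , subst (λ j → IsR⁰ φ j R) (↭-length D⁰₊↭) isR , subst (R ≤_) (product-↭ D⁰₊↭) R≤
      where
      split : ∀ {p} → Π⁰ φ p × (p ∣ N ⊎ p ≡ φ) → p ≡ φ ⊎ Π⁰ φ p × p ∣ N
      split (_  , inj₂ p≡φ) = inj₁ p≡φ
      split (p⁰ , inj₁ p∣N) = inj₂ (p⁰ , p∣N)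
      D⁰₊↭ : filter D⁰₊? U ↭ φ ∷ F⁰
      D⁰₊↭ = filter-insert-↭ _≟_ D⁰₊? D⁰? (Unique.upTo⁺ (suc N)) φ∈U
               (prime∈Π⁰ pφ , inj₂ refl) (φ∤N ∘ proj₂) split (λ (p⁰ , p∣N) → p⁰ , inj₁ p∣N)

    geMin₁ : GeMin₁ φ x
    geMin₁ with k <? k′ φ | R⁰-bound | R¹-bound | R⁰₊-bound
    ... | yes k<k′ | R₀ , isR₀ , R₀≤ | R₁ , isR₁ , R₁≤ | _ =
      k , R₀ , R₁ , inj₁ ((k<k′ , k≤ω , isR₀ , isR₁) ,
                          s≤s (≤-trans R₀≤ ∏F⁰≤y) , ≤N⇒<x^φ (≤-trans (*-mono-∏F R₀≤ R₁≤) ∏F≤N))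
    ... | no k≮k′ | _ | R₁ , isR₁ , R₁≤ | R₀ , isR₀ , R₀≤ =
      k , R₀ , R₁ , inj₂ ((≮⇒≥ k≮k′ , k<ω , isR₀ , isR₁) ,
                          φ+-mono-≤ (≤-trans R₀≤ (*-monoʳ-≤ φ ∏F⁰≤y)) ,
                          subst (φ + R₀ * R₁ ≤_) (cong (φ *_) (sym x^φ≡1+N)) (φ+-mono-≤ R₀R₁≤φN))
      where
      R₀R₁≤φN : R₀ * R₁ ≤ φ * N
      R₀R₁≤φN = begin
        R₀ * R₁                           ≤⟨ *-monoˡ-≤ R₁ R₀≤ ⟩
        φ * product F⁰ * R₁               ≡⟨ *-assoc φ (product F⁰) R₁ ⟩
        φ * (product F⁰ * R₁)             ≤⟨ *-monoʳ-≤ φ (*-mono-∏F ≤-refl R₁≤) ⟩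
        φ * product F                     ≤⟨ *-monoʳ-≤ φ ∏F≤N ⟩
        φ * N                             ∎
        where open ≤-Reasoning

  module Divisible (φ∣N : φ ∣ N) where

    φ∣y : φ ∣ y
    φ∣y = Π⁰∧∣N⇒∣y (prime∈Π⁰ pφ) φ∣N

    φ∣Φ : φ ∣ Φ
    φ∣Φ = let d , Φ≡ = Φ≡φ+y*d in subst (φ ∣_) (sym Φ≡) (∣m∣n⇒∣m+n ∣-refl (∣m⇒∣m*n d φ∣y))

    a : ℕ
    a = quotient φ∣y

    y≡φa : y ≡ φ * a
    y≡φa = m∣n⇒n≡m*quotient φ∣y

    N≡φ[aΦ] : N ≡ φ * (a * Φ)
    N≡φ[aΦ] = trans N≡yΦ (trans (cong (_* Φ) y≡φa) (*-assoc φ a Φ))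

    φ∏F≤N : φ * product F ≤ N
    φ∏F≤N =
      ∣⇒≤ (subst (φ * product F ∣_) (sym N≡φ[aΦ]) (*-monoʳ-∣ φ (product-filter-∣ D? proj₁ ∣aΦ)))
      where
      ∣aΦ : ∀ {p} → Prime p × p ∣ N → p ∣ a * Φ
      ∣aΦ {p} (pp , p∣N) with p ≟ φ | euclidsLemma φ (a * Φ) pp (subst (p ∣_) N≡φ[aΦ] p∣N)
      ... | yes refl | _          = ∣n⇒∣m*n a φ∣Φ
      ... | no  p≢φ  | inj₁ p∣φ   = contradiction (prime∣prime⇒≡ pp pφ p∣φ) p≢φ
      ... | no  _    | inj₂ p∣aΦ  = p∣aΦ

    1≤k : 1 ≤ k
    1≤k = filter-some D⁰? (lose φ∈U (prime∈Π⁰ pφ , φ∣N))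

    D⁰₋? : Decidable (λ p → Π⁰ φ p × p ∣ N × p ≢ φ)
    D⁰₋? p = Π⁰? φ p ×-dec (p ∣? N) ×-dec ¬? (p ≟ φ)

    R⁰₋-bound : ∃ λ R → IsR⁰ φ (k ∸ 1) R × φ * R ≤ product F⁰
    R⁰₋-bound with prefixProd-≤-filter (Π⁰? φ) D⁰₋? proj₁ (suc N)
    ... | R , isR , R≤ = R , subst (λ j → IsR⁰ φ j R) (cong (_∸ 1) (sym (↭-length F⁰↭))) isR ,
                         subst (φ * R ≤_) (sym (product-↭ F⁰↭)) (*-monoʳ-≤ φ R≤)
      where
      split : ∀ {p} → Π⁰ φ p × p ∣ N → p ≡ φ ⊎ Π⁰ φ p × p ∣ N × p ≢ φ
      split {p} (p⁰ , p∣N) with p ≟ φ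
      ... | yes p≡φ = inj₁ p≡φ
      ... | no  p≢φ = inj₂ (p⁰ , p∣N , p≢φ)
      F⁰↭ : F⁰ ↭ φ ∷ filter D⁰₋? U
      F⁰↭ = filter-insert-↭ _≟_ D⁰? D⁰₋? (Unique.upTo⁺ (suc N)) φ∈U
              (prime∈Π⁰ pφ , φ∣N) (λ (_ , _ , φ≢φ) → φ≢φ refl) split (λ (p⁰ , p∣N , _) → p⁰ , p∣N)

    -- Φ = φ (1 + φ c′) with c′ ≥ 1, and φ is not a prime factor of 1 + φ c′.
    k<ω-odd : ∀ {h} → φ ≡ suc (h + h) → 1 ≤ h → k < ω φ x
    k<ω-odd {h} φ≡ 1≤h with geom-odd φ≡ y≡φa
    ... | c , Φ≡ with ∃-prime-divisor {1 + φ * (a * h + a * a * c)} (s≤s 1≤φc′)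
      where
      1≤φc′ : 1 ≤ φ * (a * h + a * a * c)
      1≤φc′ = *-mono-≤ (≤-trans (s≤s z≤n) (prime⇒2≤ pφ))
                (≤-trans (*-mono-≤ (>-nonZero⁻¹ a {{quotient≢0 φ∣y}}) 1≤h) (m≤m+n (a * h) (a * a * c)))
    ... | q , pq , q∣1+φc′ =
      prime-divisor-of-Φ⇒k<ω pq (subst (q ∣_) (sym Φ≡) (∣n⇒∣m*n φ q∣1+φc′)) q≢φ
      where
      c′ = a * h + a * a * c
      q≢φ : q ≢ φ
      q≢φ refl = prime∤1 pφ (∣m+n∣m⇒∣n (subst (φ ∣_) (+-comm 1 (φ * c′)) q∣1+φc′) (m∣m*n c′))

    -- Π⁰ 2 = {2}, so k ≤ 1, and ω ≥ 2 has to come from Nonempty₂ (x = 3 has ω = 1).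
    k<ω-two : φ ≡ 2 → Nonempty₂ φ x → k < ω φ x
    k<ω-two φ≡2 nonempty = ≤-<-trans k≤1 (2≤ω nonempty)
      where
      k′≡1 : k′ φ ≡ 1
      k′≡1 = subst (λ z → k′ z ≡ 1) (sym φ≡2) refl
      2≤ω : Nonempty₂ φ x → 2 ≤ ω φ x
      2≤ω (k₀ , _ , _ , inj₁ (1≤k₀ , k₀<k′ , _)) = contradiction 1≤k₀ (<⇒≱ (subst (k₀ <_) k′≡1 k₀<k′))
      2≤ω (k₀ , _ , _ , inj₂ (k′≤k₀ , k₀<ω , _)) = ≤-trans (s≤s (subst (_≤ k₀) k′≡1 k′≤k₀)) k₀<ω
      k≤1 : k ≤ 1
      k≤1 = unique-constant⇒length≤1 (Unique.filter⁺ D⁰? (Unique.upTo⁺ (suc N)))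
              (All.map (λ (p⁰ , _) → trans (Π⁰[2]⇒≡2 (subst (λ z → Π⁰ z _) φ≡2 p⁰)) (sym φ≡2))
                       (all-filter D⁰? U))

    k<ω : Nonempty₂ φ x → k < ω φ x
    k<ω nonempty with prime≡2⊎odd pφ
    ... | inj₁ φ≡2            = k<ω-two φ≡2 nonempty
    ... | inj₂ (_ , φ≡ , 1≤h) = k<ω-odd φ≡ 1≤h

    geMin₂ : Nonempty₂ φ x → GeMin₂ φ x
    geMin₂ nonempty with k <? k′ φ | R⁰₋-bound | R⁰-bound | R¹-bound
    ... | yes k<k′ | R₀ , isR₀ , φR₀≤ | _ | R₁ , isR₁ , R₁≤ =
      k , R₀ , R₁ , inj₁ ((1≤k , k<k′ , k≤ω , isR₀ , isR₁) ,
                          s≤s (≤-trans φR₀≤ ∏F⁰≤y) , ≤N⇒<x^φ φφR₀R₁≤N)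
      where
      φφR₀R₁≤N : φ * φ * R₀ * R₁ ≤ N
      φφR₀R₁≤N = begin
        φ * φ * R₀ * R₁       ≡⟨ cong (_* R₁) (*-assoc φ φ R₀) ⟩
        φ * (φ * R₀) * R₁     ≡⟨ *-assoc φ (φ * R₀) R₁ ⟩
        φ * (φ * R₀ * R₁)     ≤⟨ *-monoʳ-≤ φ (*-mono-∏F φR₀≤ R₁≤) ⟩
        φ * product F         ≤⟨ φ∏F≤N ⟩
        N                     ∎
        where open ≤-Reasoning
    ... | no k≮k′ | _ | R₀ , isR₀ , R₀≤ | R₁ , isR₁ , R₁≤ =
      k , R₀ , R₁ , inj₂ ((≮⇒≥ k≮k′ , k<ω nonempty , isR₀ , isR₁) ,
                          s≤s (≤-trans R₀≤ ∏F⁰≤y) , ≤N⇒<x^φ φR₀R₁≤N)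
      where
      φR₀R₁≤N : φ * R₀ * R₁ ≤ N
      φR₀R₁≤N = begin
        φ * R₀ * R₁           ≡⟨ *-assoc φ R₀ R₁ ⟩
        φ * (R₀ * R₁)         ≤⟨ *-monoʳ-≤ φ (*-mono-∏F R₀≤ R₁≤) ⟩
        φ * product F         ≤⟨ φ∏F≤N ⟩
        N                     ∎
        where open ≤-Reasoning

proposition3p3 : (φ x : ℕ) → Prime φ → 1 < x →
    (¬ (φ ∣ x ^ φ ∸ 1) → Nonempty₁ φ x → GeMin₁ φ x) ×
    (φ ∣ x ^ φ ∸ 1 → Nonempty₂ φ x → GeMin₂ φ x)
proposition3p3 φ (suc zero)        _  (s≤s ())
proposition3p3 φ (suc y@(suc _)) pφ _ = (λ φ∤N _ → NotDivisible.geMin₁ φ∤N) , Divisible.geMin₂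
  where open PrimeFactors φ y pφ
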